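{- Let $G$ be a finite simple graph with $n \ge 2$ vertices and no isolated vertices. Then $$\left\lceil \frac{n}{2} \right\rceil \le \gamma(M(G)) \le n-1.$$
   Context: For a finite simple graph $G$, the middle graph $M(G)$ is the graph with vertex set $V(G)\cup E(G)$ in which two elements $x,y$ are adjacent if and only if either (1) $x,y\in E(G)$ and the edges $x,y$ share a common endpoint in $G$, or (2) $x\in V(G)$, $y\in E(G)$ and $x$ is an endpoint of $y$ (or vice versa). A dominating set of a graph $H$ is a set $S\subseteq V(H)$ such that every vertex of $H$ is in $S$ or adjacent to a vertex of $S$; the domination number $\gamma(H)$ is the minimum cardinality of a dominating set of $H$. -}

module Defs where

open import Data.Nat using (ℕ; suc; _≤_; _∸_; ⌈_/2⌉)
open import Data.Fin using (Fin; _<_)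
open import Data.Bool using (Bool; true; false)
open import Data.Sum using (_⊎_; inj₁; inj₂)
open import Data.Product using (Σ; _×_; _,_; ∃)
open import Data.List using (List; length)
open import Data.List.Membership.Propositional using (_∈_)
open import Data.List.Relation.Unary.Unique.Propositional using (Unique)
open import Data.List.Relation.Unary.Any using (Any)
open import Relation.Binary.PropositionalEquality using (_≡_; _≢_)
open import Relation.Nullary using (¬_)
open import Data.Empty using (⊥)

record Graph (n : ℕ) : Set where
  field
    adj   : Fin n → Fin n → Bool
    sym   : ∀ i j → adj i j ≡ adj j i
    loopless : ∀ i → adj i i ≡ false
open Graph public

Adj : ∀ {n} → Graph n → Fin n → Fin n → Set
Adj G i j = adj G i j ≡ true

NoIsolated : ∀ {n} → Graph n → Set
NoIsolated {n} G = ∀ (i : Fin n) → ∃ λ j → Adj G i j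

-- An edge {i,j} is represented uniquely as an ordered pair i < j.
record Edge {n : ℕ} (G : Graph n) : Set where
  constructor edge
  field
    u v  : Fin n
    u<v  : u < v
    uv   : Adj G u v
open Edge public

_∈ₑ_ : ∀ {n} {G : Graph n} → Fin n → Edge G → Set
x ∈ₑ e = x ≡ u e ⊎ x ≡ v e

ShareEnd : ∀ {n} {G : Graph n} → Edge G → Edge G → Set
ShareEnd {n} {G} e f = Σ (Fin n) λ x → _∈ₑ_ {G = G} x e × _∈ₑ_ {G = G} x f

MVertex : ∀ {n} → Graph n → Set
MVertex {n} G = Fin n ⊎ Edge G

MAdj : ∀ {n} {G : Graph n} → MVertex G → MVertex G → Set
MAdj (inj₁ x) (inj₁ y) = ⊥
MAdj {G = G} (inj₁ x) (inj₂ e) = _∈ₑ_ {G = G} x e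
MAdj {G = G} (inj₂ e) (inj₁ x) = _∈ₑ_ {G = G} x e
MAdj {G = G} (inj₂ e) (inj₂ f) = (e ≢ f) × ShareEnd {G = G} e f

Dominating : ∀ {n} {G : Graph n} → List (MVertex G) → Set
Dominating {G = G} S = ∀ (w : MVertex G) → w ∈ S ⊎ Any (λ s → MAdj s w) S

DominationNumberM : ∀ {n} → Graph n → ℕ → Set
DominationNumberM G k =
  (Σ (List (MVertex G)) λ S → Unique S × Dominating S × length S ≡ k)
  × (∀ (S : List (MVertex G)) → Unique S → Dominating S → k ≤ length S)

module Submission where

-- An element of M(G) can dominate at most two vertices of G:
-- a vertex x dominates only itself (vertices of G are pairwise non-adjacent
-- in M(G)), and an edge dominates exactly its two endpoints.  Listing the
-- vertices of G touched by the members of a dominating list S therefore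
-- gives a list of length ≤ 2·|S| containing every vertex, so by the
-- pigeonhole principle n ≤ 2·|S|, i.e. ⌈n/2⌉ ≤ |S|.
--
-- If G has an edge e = ab, then S = e ∷ (V(G) ∖ {a, b}) is a
-- dominating set of M(G) without repetitions of size n − 1: a and b are
-- dominated by e, every other vertex lies in S, and an edge f is dominated
-- by its endpoint u(f) when u(f) ∉ {a, b}, and otherwise is e itself or
-- shares an endpoint with e.

open import Defs hiding (sym)
open import Data.Nat using (ℕ; suc; _+_; _≤_; _<_; _∸_; ⌈_/2⌉; z≤n; s≤s; s≤s⁻¹)
open import Data.Nat.Properties using (≤-trans; ≤-reflexive; ≮⇒≥; +-suc; +-monoʳ-≤; n≤1+n; ⌈n/2⌉-mono; n≡⌈n+n/2⌉)
open import Data.Fin using (Fin; _≟_)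
import Data.Fin as Fin
open import Data.Fin.Properties using (<-cmp; <-irrelevant; <-irrefl; pigeonhole)
import Data.Bool as Bool
open import Data.List using (List; []; _∷_; _++_; length; map; filter; allFin; lookup)
open import Data.List.Properties using (length-map; length-tabulate; filter-notAll)
open import Data.List.Membership.Propositional using (_∈_)
open import Data.List.Membership.Propositional.Properties using (∈-++⁺ˡ; ∈-++⁺ʳ; ∈-map⁺; ∈-filter⁺; ∈-allFin)
open import Data.List.Relation.Unary.Any as Any using (Any; here; there)
open import Data.List.Relation.Unary.Any.Properties using (lookup-index)
open import Data.List.Relation.Unary.All using (All; universal)
import Data.List.Relation.Unary.All.Properties as All
open import Data.List.Relation.Unary.Unique.Propositional using (Unique; _∷_)
import Data.List.Relation.Unary.Unique.Propositional.Properties as Unique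
open import Data.Product using (_×_; _,_; proj₂)
open import Data.Sum using (_⊎_; inj₁; inj₂)
open import Relation.Nullary using (¬_; Dec; yes; no; ¬?)
open import Relation.Binary using (tri<; tri≈; tri>)
open import Relation.Binary.PropositionalEquality using (_≡_; refl; sym; trans; cong; cong₂; subst)
open import Axiom.UniquenessOfIdentityProofs using (module Decidable⇒UIP)

∈⇒Any : ∀ {A : Set} {P : A → Set} {x : A} {xs : List A} → x ∈ xs → P x → Any P xs
∈⇒Any px∈ px = Any.map (λ { refl → px }) px∈

-- Pigeonhole: a list containing every element of Fin n has length ≥ n
-- (otherwise two elements would be found at the same position).
covering⇒≥ : ∀ {n} (L : List (Fin n)) → (∀ x → x ∈ L) → n ≤ length L
covering⇒≥ L has = ≮⇒≥ λ short →
  let (i , j , i<j , same) = pigeonhole short (λ x → Any.index (has x))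
  in <-irrefl (trans (lookup-index (has i))
                     (trans (cong (lookup L) same) (sym (lookup-index (has j)))))
              i<j

module _ {n : ℕ} {G : Graph n} where

  -- Two edges with the same endpoints are equal: the proof components are
  -- propositions (a strict order on Fin n and an equation between booleans).
  edge-ext : ∀ {e f : Edge G} → u e ≡ u f → v e ≡ v f → e ≡ f
  edge-ext {edge x y x<y xy} {edge .x .y x<y′ xy′} refl refl =
    cong₂ (edge x y) (<-irrelevant x<y x<y′) (Decidable⇒UIP.≡-irrelevant Bool._≟_ xy xy′)

  _≟ₑ_ : (e f : Edge G) → Dec (e ≡ f)
  e ≟ₑ f with u e ≟ u f | v e ≟ v f
  ... | yes uu | yes vv = yes (edge-ext uu vv)
  ... | no  uu | _      = no (λ e≡f → uu (cong u e≡f))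
  ... | yes _  | no  vv = no (λ e≡f → vv (cong v e≡f))

  -- Any two adjacent vertices span an edge (they differ, as G is loopless).
  edgeBetween : ∀ {i j : Fin n} → Adj G i j → Edge G
  edgeBetween {i} {j} ij with <-cmp i j
  ... | tri< i<j _ _ = edge i j i<j ij
  ... | tri> _ _ j<i = edge j i j<i (trans (Defs.sym G j i) ij)
  ... | tri≈ _ refl _ with trans (sym ij) (loopless G i)
  ...   | ()

  touched : MVertex G → List (Fin n)
  touched (inj₁ x) = x ∷ []
  touched (inj₂ e) = u e ∷ v e ∷ []

  touchedBy : List (MVertex G) → List (Fin n)
  touchedBy []      = []
  touchedBy (s ∷ S) = touched s ++ touchedBy S

  length-touchedBy : ∀ S → length (touchedBy S) ≤ length S + length S
  length-touchedBy []           = z≤n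
  length-touchedBy (inj₁ x ∷ S) =
    s≤s (≤-trans (length-touchedBy S) (+-monoʳ-≤ (length S) (n≤1+n _)))
  length-touchedBy (inj₂ e ∷ S) =
    s≤s (≤-trans (s≤s (length-touchedBy S)) (≤-reflexive (sym (+-suc (length S) (length S)))))

  ∈-touchedBy : ∀ {x} S → Any (λ s → x ∈ touched s) S → x ∈ touchedBy S
  ∈-touchedBy (s ∷ S) (here x∈s) = ∈-++⁺ˡ x∈s
  ∈-touchedBy (s ∷ S) (there p)  = ∈-++⁺ʳ (touched s) (∈-touchedBy S p)

  dominating⇒touches-all : ∀ S → Dominating S → ∀ x → x ∈ touchedBy S
  dominating⇒touches-all S dom x with dom (inj₁ x)
  ... | inj₁ x∈S    = ∈-touchedBy S (Any.map (λ { refl → here refl }) x∈S)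
  ... | inj₂ adjToX = ∈-touchedBy S (Any.map adjacent⇒touched adjToX)
    where
    adjacent⇒touched : ∀ {s} → MAdj s (inj₁ x) → x ∈ touched s
    adjacent⇒touched {inj₂ e} (inj₁ x≡u) = here x≡u
    adjacent⇒touched {inj₂ e} (inj₂ x≡v) = there (here x≡v)

  dominating-lower : ∀ S → Dominating S → ⌈ n /2⌉ ≤ length S
  dominating-lower S dom = subst (⌈ n /2⌉ ≤_) (sym (n≡⌈n+n/2⌉ (length S)))
    (⌈n/2⌉-mono (≤-trans (covering⇒≥ (touchedBy S) (dominating⇒touches-all S dom))
                         (length-touchedBy S)))

  module AroundEdge (e : Edge G) where

    a b : Fin n
    a = u e
    b = v e

    a≢b : ¬ a ≡ b
    a≢b a≡b = <-irrefl a≡b (u<v e)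

    notA? : (i : Fin n) → Dec (¬ i ≡ a)
    notA? i = ¬? (i ≟ a)

    notB? : (i : Fin n) → Dec (¬ i ≡ b)
    notB? i = ¬? (i ≟ b)

    others : List (Fin n)
    others = filter notB? (filter notA? (allFin n))

    dominator : List (MVertex G)
    dominator = inj₂ e ∷ map inj₁ others

    vertex∈dominator : ∀ i → ¬ i ≡ a → ¬ i ≡ b → inj₁ i ∈ dominator
    vertex∈dominator i i≢a i≢b =
      there (∈-map⁺ inj₁ (∈-filter⁺ notB? (∈-filter⁺ notA? (∈-allFin i) i≢a) i≢b))

    unique-dominator : Unique dominator
    unique-dominator =
      All.map⁺ (universal (λ _ ()) others)
      ∷ Unique.map⁺ (λ { refl → refl })
          (Unique.filter⁺ notB? (Unique.filter⁺ notA? (Unique.allFin⁺ n)))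

    -- Each filter removes at least one vertex (a, resp. b), so two in total.
    length-dominator : suc (length dominator) ≤ n
    length-dominator =
      subst (λ k → suc (suc k) ≤ n) (sym (length-map inj₁ others))
        (≤-trans (s≤s (filter-notAll notB? _ (∈⇒Any b∈withoutA (λ b≢b → b≢b refl))))
          (subst (length (filter notA? (allFin n)) <_) (length-tabulate {n = n} (λ i → i))
            (filter-notAll notA? (allFin n) (∈⇒Any (∈-allFin a) (λ a≢a → a≢a refl)))))
      where
      b∈withoutA : b ∈ filter notA? (allFin n)
      b∈withoutA = ∈-filter⁺ notA? (∈-allFin b) (λ b≡a → a≢b (sym b≡a))

    via-e : ∀ f x → x ∈ₑ e → x ≡ u f → inj₂ f ∈ dominator ⊎ Any (λ s → MAdj s (inj₂ f)) dominator
    via-e f x x∈e x≡uf with e ≟ₑ f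
    ... | yes refl = inj₁ (here refl)
    ... | no  e≢f  = inj₂ (here (e≢f , x , x∈e , inj₁ x≡uf))

    dominating : Dominating dominator
    dominating (inj₁ x) with x ≟ a | x ≟ b
    ... | yes x≡a | _       = inj₂ (here (inj₁ x≡a))
    ... | no _    | yes x≡b = inj₂ (here (inj₂ x≡b))
    ... | no x≢a  | no x≢b  = inj₁ (vertex∈dominator x x≢a x≢b)
    dominating (inj₂ f) with u f ≟ a | u f ≟ b
    ... | yes uf≡a | _        = via-e f (u f) (inj₁ uf≡a) refl
    ... | no _     | yes uf≡b = via-e f (u f) (inj₂ uf≡b) refl
    ... | no uf≢a  | no uf≢b  = inj₂ (∈⇒Any (vertex∈dominator (u f) uf≢a uf≢b) (inj₁ refl))

theorem2p7 : (n : ℕ) → 2 ≤ n → (G : Graph n) → NoIsolated G →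
    (k : ℕ) → DominationNumberM G k →
    ⌈ n /2⌉ ≤ k × k ≤ n ∸ 1
theorem2p7 (suc m) _ G noIsolated k ((S , _ , domS , |S|≡k) , minimal) =
  subst (⌈ suc m /2⌉ ≤_) |S|≡k (dominating-lower S domS) ,
  ≤-trans (minimal dominator unique-dominator dominating) (s≤s⁻¹ length-dominator)
  where
  -- Vertex 0 is not isolated, so G has an edge.
  open AroundEdge (edgeBetween {G = G} (proj₂ (noIsolated Fin.zero)))
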